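{- For every $k\ge 0$, the language $\bigcap_{i=0}^k L(M_{i,k})$ is nonempty and the minimum length of a word in $\bigcap_{i=0}^k L(M_{i,k})$ is $2^k$.
   Context: For $i,k\ge0$, $M_{i,k}$ is the DFA with states $Q=\{q_0,q_1,q^*\}$ over the alphabet $\{0,1,\dots,k\}$, initial state $q_0$, and transition function $\delta_{i,k}$ equal to the restriction to $Q\times\{0,\dots,k\}$ of $\delta_i\colon Q\times\mathbb N\to Q$ defined as follows. For $i=0$: $\delta_0(q_0,j)=q_1$ if $j=0$ and $q^*$ otherwise; $\delta_0(q_1,j)=q_1$ if $j\ne0$ and $q^*$ otherwise; $\delta_0(q^*,j)=q^*$. For $i\ge1$: $\delta_i(q_0,j)=q_0$ if $j>i$, $q_1$ if $j<i$, $q^*$ if $j=i$; $\delta_i(q_1,j)=q_0$ if $j=i$, $q_1$ if $j>i$, $q^*$ if $j<i$; $\delta_i(q^*,j)=q^*$. The accepting set of $M_{0,k}$ is $\{q_1\}$ and that of $M_{i,k}$ for $i\ge1$ is $\{q_0\}$. $L(M)$ is the set of words $w$ with $\delta(q_0,w)$ accepting (transition function extended to words). -}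

module Defs where

open import Data.Nat using (ℕ; zero; suc; _<ᵇ_; _≡ᵇ_; _≤_)
open import Data.Bool using (Bool; true; false; if_then_else_)
open import Data.Fin using (Fin; toℕ)
open import Data.List using (List; []; _∷_; foldl)
open import Relation.Binary.PropositionalEquality using (_≡_)

data Q : Set where
  q0 q1 q* : Q

δ : ℕ → Q → ℕ → Q
δ zero q0 j = if j ≡ᵇ 0 then q1 else q*
δ zero q1 j = if j ≡ᵇ 0 then q* else q1
δ zero q* j = q*
δ (suc i) q0 j =
  if suc i <ᵇ j then q0 else (if j <ᵇ suc i then q1 else q*)
δ (suc i) q1 j =
  if j ≡ᵇ suc i then q0 else (if suc i <ᵇ j then q1 else q*)
δ (suc i) q* j = q*

δ-res : (i k : ℕ) → Q → Fin (suc k) → Q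
δ-res i k q a = δ i q (toℕ a)

δ* : (i k : ℕ) → Q → List (Fin (suc k)) → Q
δ* i k q w = foldl (δ-res i k) q w

Accepting : ℕ → Q → Set
Accepting zero q = q ≡ q1
Accepting (suc i) q = q ≡ q0

L : (i k : ℕ) → List (Fin (suc k)) → Set
L i k w = Accepting i (δ* i k q0 w)

InAll : (k : ℕ) → List (Fin (suc k)) → Set
InAll k w = (i : ℕ) → i ≤ k → L i k w

{-# OPTIONS --safe #-}
-- Write #<i w and #=i w for the numbers of letters of w below i and equal to i.
-- A word accepted by M_0 has #=0 w = 1, and a run of M_i (i ≥ 1) ending in q₀
-- alternates "a letter below i" with "the letter i", so #=i w = #<i w.
-- Since #<(i+1) = #<i + #=i, a word accepted by all M_i, i ≤ k, has
-- #<(i+1) w = 2^i for all i ≤ k, and #<(k+1) w is its length.  Conversely,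
-- following every letter of such a word by k+1 gives a word of twice the
-- length accepted by all M_i, i ≤ k+1, starting from the one-letter word 0.
module Submission where

open import Defs
open import Data.Bool using (Bool; true; false; if_then_else_; _∧_; _∨_)
open import Data.Fin using (Fin; toℕ; inject₁; fromℕ) renaming (zero to fzero)
open import Data.Fin.Properties using (toℕ<n; toℕ-inject₁; toℕ-fromℕ)
open import Data.List using (List; []; _∷_; length; map; foldl)
open import Data.List.Properties using (foldl-map)
open import Data.Nat
  using (ℕ; zero; suc; _+_; _*_; _^_; _≤_; _<_; _<ᵇ_; _≡ᵇ_; s≤s; z≤n)
open import Data.Nat.Properties
  using (_<?_; _≟_; <-cmp; <-irrefl; <⇒≢; >⇒≢; <⇒≯; ≤-refl; ≤-reflexive; ≤-pred;
         n≤1+n; ≤-trans; m≤n⇒m<n∨m≡n; +-suc; +-identityʳ; *-suc)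
open import Data.Product using (Σ; _×_; _,_)
open import Data.Sum using (inj₁; inj₂)
open import Relation.Binary.Definitions using (tri<; tri≈; tri>)
open import Relation.Binary.PropositionalEquality
  using (_≡_; _≢_; refl; sym; trans; cong; subst; module ≡-Reasoning)
open import Relation.Nullary using (¬_; contradiction)
open import Relation.Nullary.Decidable using (dec-true; dec-false)

private
  variable
    A : Set
    i k m n : ℕ

<ᵇ-true : m < n → (m <ᵇ n) ≡ true
<ᵇ-true {m} {n} = dec-true (m <? n)

<ᵇ-false : ¬ m < n → (m <ᵇ n) ≡ false
<ᵇ-false {m} {n} = dec-false (m <? n)

≡ᵇ-refl : ∀ n → (n ≡ᵇ n) ≡ true
≡ᵇ-refl n = dec-true (n ≟ n) refl

≡ᵇ-false : m ≢ n → (m ≡ᵇ n) ≡ false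
≡ᵇ-false {m} {n} = dec-false (m ≟ n)

<ᵇ-suc : ∀ m n → (m <ᵇ suc n) ≡ ((m <ᵇ n) ∨ (m ≡ᵇ n))
<ᵇ-suc zero    zero    = refl
<ᵇ-suc zero    (suc n) = refl
<ᵇ-suc (suc m) zero    = refl
<ᵇ-suc (suc m) (suc n) = <ᵇ-suc m n

<ᵇ-∧-≡ᵇ : ∀ m n → ((m <ᵇ n) ∧ (m ≡ᵇ n)) ≡ false
<ᵇ-∧-≡ᵇ zero    zero    = refl
<ᵇ-∧-≡ᵇ zero    (suc n) = refl
<ᵇ-∧-≡ᵇ (suc m) zero    = refl
<ᵇ-∧-≡ᵇ (suc m) (suc n) = <ᵇ-∧-≡ᵇ m n

countᵇ : (A → Bool) → List A → ℕ
countᵇ p []       = 0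
countᵇ p (x ∷ xs) = if p x then suc (countᵇ p xs) else countᵇ p xs

countᵇ-∨ : {p q r : A → Bool} →
           (∀ x → p x ≡ (q x ∨ r x)) → (∀ x → (q x ∧ r x) ≡ false) →
           ∀ xs → countᵇ p xs ≡ countᵇ q xs + countᵇ r xs
countᵇ-∨ p≡q∨r q∧r≡false [] = refl
countᵇ-∨ {q = q} {r} p≡q∨r q∧r≡false (x ∷ xs)
  rewrite p≡q∨r x with q x | r x | q∧r≡false x
... | true  | false | _ = cong suc (countᵇ-∨ p≡q∨r q∧r≡false xs)
... | false | true  | _ =
  trans (cong suc (countᵇ-∨ p≡q∨r q∧r≡false xs)) (sym (+-suc _ _))
... | false | false | _ = countᵇ-∨ p≡q∨r q∧r≡false xs

countᵇ-<ᵇ-suc : ∀ i ns →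
                countᵇ (_<ᵇ suc i) ns ≡ countᵇ (_<ᵇ i) ns + countᵇ (_≡ᵇ i) ns
countᵇ-<ᵇ-suc i = countᵇ-∨ (λ n → <ᵇ-suc n i) (λ n → <ᵇ-∧-≡ᵇ n i)

countᵇ-<ᵇ-toℕ : (w : List (Fin n)) → countᵇ (_<ᵇ n) (map toℕ w) ≡ length w
countᵇ-<ᵇ-toℕ []      = refl
countᵇ-<ᵇ-toℕ (a ∷ w) rewrite <ᵇ-true (toℕ<n a) = cong suc (countᵇ-<ᵇ-toℕ w)

δ*-toℕ : ∀ i k q (w : List (Fin (suc k))) → δ* i k q w ≡ foldl (δ i) q (map toℕ w)
δ*-toℕ i k q w = sym (foldl-map (δ i) toℕ q w)

foldl-δ-q* : ∀ i ns → foldl (δ i) q* ns ≡ q*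
foldl-δ-q* i       []       = refl
foldl-δ-q* zero    (n ∷ ns) = foldl-δ-q* zero ns
foldl-δ-q* (suc i) (n ∷ ns) = foldl-δ-q* (suc i) ns

foldl-δ-q*⇒ : ∀ i {q} ns → foldl (δ i) q* ns ≡ q → q ≡ q*
foldl-δ-q*⇒ i ns run = trans (sym run) (foldl-δ-q* i ns)

foldl-δ-step : ∀ i q n ns {q′ r} → δ i q n ≡ q′ →
               foldl (δ i) q (n ∷ ns) ≡ r → foldl (δ i) q′ ns ≡ r
foldl-δ-step i q n ns {r = r} step run = subst (λ q → foldl (δ i) q ns ≡ r) step run

δ-suc-q0-< : n < suc i → δ (suc i) q0 n ≡ q1
δ-suc-q0-< n<1+i rewrite <ᵇ-false (<⇒≯ n<1+i) | <ᵇ-true n<1+i = refl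

δ-suc-q1-< : n < suc i → δ (suc i) q1 n ≡ q*
δ-suc-q1-< n<1+i rewrite ≡ᵇ-false (<⇒≢ n<1+i) | <ᵇ-false (<⇒≯ n<1+i) = refl

δ-suc-q0-≡ : ∀ i → δ (suc i) q0 (suc i) ≡ q*
δ-suc-q0-≡ i rewrite <ᵇ-false (<-irrefl {suc i} refl) = refl

δ-suc-q1-≡ : ∀ i → δ (suc i) q1 (suc i) ≡ q0
δ-suc-q1-≡ i rewrite ≡ᵇ-refl i = refl

δ-suc-> : suc i < n → ∀ q → δ (suc i) q n ≡ q
δ-suc-> 1+i<n q0 rewrite <ᵇ-true 1+i<n = refl
δ-suc-> 1+i<n q1 rewrite ≡ᵇ-false (>⇒≢ 1+i<n) | <ᵇ-true 1+i<n = refl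
δ-suc-> 1+i<n q* = refl

-- For i = 0 this fails at q0 itself, which every nonzero letter sends to q*.
δ-idle : i < m → ∀ q n → δ i (δ i q n) m ≡ δ i q n
δ-idle {zero}  {suc m} _   q0 zero    = refl
δ-idle {zero}  {suc m} _   q0 (suc n) = refl
δ-idle {zero}  {suc m} _   q1 zero    = refl
δ-idle {zero}  {suc m} _   q1 (suc n) = refl
δ-idle {zero}  {suc m} _   q* n       = refl
δ-idle {suc i}         i<m q  n       = δ-suc-> i<m (δ (suc i) q n)

mutual
  δ-zero-q0⇝q1 : ∀ ns → foldl (δ zero) q0 ns ≡ q1 → countᵇ (_<ᵇ 1) ns ≡ 1
  δ-zero-q0⇝q1 (zero  ∷ ns) run = cong suc (δ-zero-q1⇝q1 ns run)
  δ-zero-q0⇝q1 (suc n ∷ ns) run = contradiction (foldl-δ-q*⇒ zero ns run) λ ()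

  δ-zero-q1⇝q1 : ∀ ns → foldl (δ zero) q1 ns ≡ q1 → countᵇ (_<ᵇ 1) ns ≡ 0
  δ-zero-q1⇝q1 []           run = refl
  δ-zero-q1⇝q1 (zero  ∷ ns) run = contradiction (foldl-δ-q*⇒ zero ns run) λ ()
  δ-zero-q1⇝q1 (suc n ∷ ns) run = δ-zero-q1⇝q1 ns run

mutual
  δ-suc-q0⇝q0 : ∀ i ns → foldl (δ (suc i)) q0 ns ≡ q0 →
                countᵇ (_≡ᵇ suc i) ns ≡ countᵇ (_<ᵇ suc i) ns
  δ-suc-q0⇝q0 i [] run = refl
  δ-suc-q0⇝q0 i (n ∷ ns) run with <-cmp n (suc i)
  ... | tri< n<1+i _ _
    with δ-suc-q1⇝q0 i ns (foldl-δ-step (suc i) q0 n ns (δ-suc-q0-< n<1+i) run)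
  ... | ih rewrite ≡ᵇ-false (<⇒≢ n<1+i) | <ᵇ-true n<1+i = ih
  δ-suc-q0⇝q0 i (n ∷ ns) run | tri≈ _ refl _ = contradiction
    (foldl-δ-q*⇒ (suc i) ns (foldl-δ-step (suc i) q0 n ns (δ-suc-q0-≡ i) run)) λ ()
  δ-suc-q0⇝q0 i (n ∷ ns) run | tri> _ _ n>1+i
    with δ-suc-q0⇝q0 i ns (foldl-δ-step (suc i) q0 n ns (δ-suc-> n>1+i q0) run)
  ... | ih rewrite ≡ᵇ-false (>⇒≢ n>1+i) | <ᵇ-false (<⇒≯ n>1+i) = ih

  δ-suc-q1⇝q0 : ∀ i ns → foldl (δ (suc i)) q1 ns ≡ q0 →
                countᵇ (_≡ᵇ suc i) ns ≡ suc (countᵇ (_<ᵇ suc i) ns)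
  δ-suc-q1⇝q0 i (n ∷ ns) run with <-cmp n (suc i)
  ... | tri< n<1+i _ _ = contradiction
    (foldl-δ-q*⇒ (suc i) ns (foldl-δ-step (suc i) q1 n ns (δ-suc-q1-< n<1+i) run)) λ ()
  ... | tri≈ _ refl _
    with δ-suc-q0⇝q0 i ns (foldl-δ-step (suc i) q1 n ns (δ-suc-q1-≡ i) run)
  ... | ih rewrite ≡ᵇ-refl i | <ᵇ-false (<-irrefl {suc i} refl) = cong suc ih
  δ-suc-q1⇝q0 i (n ∷ ns) run | tri> _ _ n>1+i
    with δ-suc-q1⇝q0 i ns (foldl-δ-step (suc i) q1 n ns (δ-suc-> n>1+i q1) run)
  ... | ih rewrite ≡ᵇ-false (>⇒≢ n>1+i) | <ᵇ-false (<⇒≯ n>1+i) = ih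

AcceptedUpTo : ℕ → List ℕ → Set
AcceptedUpTo k ns = ∀ i → i ≤ k → Accepting i (foldl (δ i) q0 ns)

InAll⇒AcceptedUpTo : (w : List (Fin (suc k))) → InAll k w → AcceptedUpTo k (map toℕ w)
InAll⇒AcceptedUpTo {k} w inAll i i≤k =
  subst (Accepting i) (δ*-toℕ i k q0 w) (inAll i i≤k)

countᵇ-<ᵇ-accepted : ∀ ns → AcceptedUpTo k ns →
                     ∀ i → i ≤ k → countᵇ (_<ᵇ suc i) ns ≡ 2 ^ i
countᵇ-<ᵇ-accepted ns acc zero    _     = δ-zero-q0⇝q1 ns (acc zero z≤n)
countᵇ-<ᵇ-accepted ns acc (suc i) 1+i≤k = begin
  countᵇ (_<ᵇ suc (suc i)) ns                   ≡⟨ countᵇ-<ᵇ-suc (suc i) ns ⟩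
  countᵇ (_<ᵇ suc i) ns + countᵇ (_≡ᵇ suc i) ns  ≡⟨ cong (below +_) at≡below ⟩
  below + below                                  ≡⟨ cong (λ c → c + c) ih ⟩
  2 ^ i + 2 ^ i                                  ≡⟨ cong (2 ^ i +_) (+-identityʳ (2 ^ i)) ⟨
  2 ^ suc i                                      ∎
  where
  open ≡-Reasoning
  below : ℕ
  below = countᵇ (_<ᵇ suc i) ns
  at≡below : countᵇ (_≡ᵇ suc i) ns ≡ below
  at≡below = δ-suc-q0⇝q0 i ns (acc (suc i) 1+i≤k)
  ih : below ≡ 2 ^ i
  ih = countᵇ-<ᵇ-accepted ns acc i (≤-trans (n≤1+n i) 1+i≤k)

InAll⇒length≡2^k : (w : List (Fin (suc k))) → InAll k w → length w ≡ 2 ^ k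
InAll⇒length≡2^k {k} w inAll = begin
  length w                        ≡⟨ countᵇ-<ᵇ-toℕ w ⟨
  countᵇ (_<ᵇ suc k) (map toℕ w)  ≡⟨ countᵇ-<ᵇ-accepted (map toℕ w) accepted k ≤-refl ⟩
  2 ^ k                           ∎
  where
  open ≡-Reasoning
  accepted : AcceptedUpTo k (map toℕ w)
  accepted = InAll⇒AcceptedUpTo w inAll

weave : List (Fin (suc k)) → List (Fin (suc (suc k)))
weave     []      = []
weave {k} (a ∷ w) = inject₁ a ∷ fromℕ (suc k) ∷ weave w

length-weave : (w : List (Fin (suc k))) → length (weave w) ≡ 2 * length w
length-weave []      = refl
length-weave (a ∷ w) = trans (cong (2 +_) (length-weave w)) (sym (*-suc 2 (length w)))

δ*-weave : i ≤ k → ∀ q (w : List (Fin (suc k))) → δ* i (suc k) q (weave w) ≡ δ* i k q w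
δ*-weave         i≤k q []      = refl
δ*-weave {k = k} i≤k q (a ∷ w)
  rewrite toℕ-inject₁ a | toℕ-fromℕ (suc k) | δ-idle (s≤s i≤k) q (toℕ a) =
  δ*-weave i≤k _ w

δ*-weave-top : ∀ k (w : List (Fin (suc k))) → δ* (suc k) (suc k) q0 (weave w) ≡ q0
δ*-weave-top k []      = refl
δ*-weave-top k (a ∷ w)
  rewrite toℕ-inject₁ a | toℕ-fromℕ (suc k) | δ-suc-q0-< (toℕ<n a) | δ-suc-q1-≡ k =
  δ*-weave-top k w

InAll-weave : (w : List (Fin (suc k))) → InAll k w → InAll (suc k) (weave w)
InAll-weave {k} w inAll i i≤1+k with m≤n⇒m<n∨m≡n i≤1+k
... | inj₁ i<1+k = subst (Accepting i) (sym (δ*-weave i≤k q0 w)) (inAll i i≤k)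
  where
  i≤k : i ≤ k
  i≤k = ≤-pred i<1+k
... | inj₂ refl  = δ*-weave-top k w

witness : ∀ k → List (Fin (suc k))
witness zero    = fzero ∷ []
witness (suc k) = weave (witness k)

InAll-witness : ∀ k → InAll k (witness k)
InAll-witness zero    zero    _  = refl
InAll-witness zero    (suc i) ()
InAll-witness (suc k)            = InAll-weave (witness k) (InAll-witness k)

length-witness : ∀ k → length (witness k) ≡ 2 ^ k
length-witness zero    = refl
length-witness (suc k) = trans (length-weave (witness k)) (cong (2 *_) (length-witness k))

theoremB1 : (k : ℕ) →
    Σ (List (Fin (suc k))) (λ w → InAll k w × length w ≡ 2 ^ k)
    × ((w : List (Fin (suc k))) → InAll k w → 2 ^ k ≤ length w)
theoremB1 k =
  (witness k , InAll-witness k , length-witness k) ,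
  λ w inAll → ≤-reflexive (sym (InAll⇒length≡2^k w inAll))
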